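{- Let $n\geq 2$ be a fixed integer. Then \[ \liminf_{q\rightarrow\infty}\frac{C(n,q)}{q^n/n}\geq \left(\frac{n-1}{n}\right)^{n-1}. \]
   Context: Let $F$ be a finite alphabet with $|F|=q$. Two words $u,v\in F^n$ (not necessarily distinct) are overlapping if a non-empty proper prefix of $u$ equals a non-empty proper suffix of $v$, or a non-empty proper prefix of $v$ equals a non-empty proper suffix of $u$. A code $C\subseteq F^n$ is non-overlapping if for all (not necessarily distinct) $u,v\in C$, the words $u$ and $v$ are not overlapping. $C(n,q)$ denotes the maximum cardinality of a non-overlapping code $C\subseteq F^n$ with $|F|=q$. -}

module Defs where

open import Data.Nat using (ℕ; zero; suc; _∸_; _≤_; _<_)
open import Data.Fin using (Fin)
open import Data.Vec using (Vec; toList)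
open import Data.List using (List; take; drop; length)
open import Data.List.Membership.Propositional using (_∈_)
open import Data.List.Relation.Unary.Unique.Propositional using (Unique)
open import Data.Product using (_×_; ∃-syntax)
open import Data.Sum using (_⊎_)
open import Relation.Binary.PropositionalEquality using (_≡_)
open import Relation.Nullary using (¬_)
open import Data.Integer using (+_)
open import Data.Rational using (ℚ; _/_; 1ℚ; 0ℚ; _*_)

Word : ℕ → ℕ → Set
Word n q = Vec (Fin q) n

PrefixIsSuffix : ∀ {n q} → Word n q → Word n q → Set
PrefixIsSuffix {n} u v =
  ∃[ k ] (0 < k × k < n × take k (toList u) ≡ drop (n ∸ k) (toList v))

Overlapping : ∀ {n q} → Word n q → Word n q → Set
Overlapping u v = PrefixIsSuffix u v ⊎ PrefixIsSuffix v u

-- A code is a duplicate-free list of words (a finite subset of F^n);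
-- it is non-overlapping if no two (not necessarily distinct) codewords overlap.
NonOverlapping : ∀ {n q} → List (Word n q) → Set
NonOverlapping C = ∀ u v → u ∈ C → v ∈ C → ¬ Overlapping u v

-- IsC n q m : m = C(n,q), the maximum cardinality of a non-overlapping code in F^n, |F| = q.
IsC : ℕ → ℕ → ℕ → Set
IsC n q m =
  (∃[ C ] (Unique C × NonOverlapping {n} {q} C × length C ≡ m))
  × (∀ (C : List (Word n q)) → Unique C → NonOverlapping C → length C ≤ m)

ℕ→ℚ : ℕ → ℚ
ℕ→ℚ m = + m / 1

-- a / b as a rational (b = 0 gives 0; only used with b ≥ 2)
frac : ℕ → ℕ → ℚ
frac a zero = 0ℚ
frac a (suc b) = + a / suc b

_^ℚ_ : ℚ → ℕ → ℚ
x ^ℚ zero = 1ℚ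
x ^ℚ suc k = x * (x ^ℚ k)

const : ℕ → ℚ
const n = frac (n ∸ 1) n ^ℚ (n ∸ 1)

-- Split the alphabet into a = ⌊q/n⌋ marker letters and t = q − a other letters. The words made of
-- one marker followed by n − 1 non-markers form a non-overlapping code: a non-empty proper prefix
-- starts with a marker, while a proper suffix consists of non-markers only. Hence
-- n C(n,q) ≥ n a t^(n−1) ≥ ((n−1)/n)^(n−1) (na)^n. Writing q = na + r with r < n, the loss from
-- (na)^n to q^n is at most n² q^(n−1), which is below ε q^n = (p/d) q^n once q ≥ (n−1)^(n−1) n² d.
module Submission where

open import Defs
open import Data.Nat using (ℕ; zero; suc; _+_; _*_; _∸_; _^_; _≤_; s≤s; z≤n)
import Data.Nat as ℕ
open import Data.Nat.Properties
open import Data.Nat.DivMod using (_/_; _%_; m/n≤m; m/n*n≤m; m%n<n; m≡m%n+[m/n]*n)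
open import Data.Nat.Tactic.RingSolver using (solve-∀)
open import Data.Integer using (+_; +[1+_]; -[1+_])
import Data.Integer as ℤ
import Data.Integer.Properties as ℤ
open import Data.Rational using (ℚ; mkℚ; _-_; _<_; 0ℚ; *<*; toℚᵘ)
import Data.Rational as Q
open import Data.Rational.Properties
  using (toℚᵘ-cancel-≤; toℚᵘ-homo-*; toℚᵘ-homo-+; toℚᵘ-homo‿-; toℚᵘ-fromℚᵘ)
open import Data.Rational.Unnormalised using (ℚᵘ; mkℚᵘ; ↥_; ↧ₙ_)
import Data.Rational.Unnormalised as ℚᵘ
import Data.Rational.Unnormalised.Properties as ℚᵘ
open import Data.Rational.Unnormalised.Solver using (module +-*-Solver)
open import Data.Fin using (Fin; _↑ˡ_; _↑ʳ_; splitAt)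
open import Data.Fin.Properties using (↑ˡ-injective; ↑ʳ-injective; splitAt-↑ˡ; splitAt-↑ʳ)
open import Data.Vec using (Vec; []; _∷_; toList)
import Data.Vec.Properties as Vec
open import Data.List using (List; []; _∷_; [_]; map; allFin; length; take; drop; cartesianProductWith; _++_)
open import Data.List.Properties using (length-++; length-map; length-tabulate)
open import Data.List.Membership.Propositional using (_∈_; _∉_)
open import Data.List.Membership.Propositional.Properties using (∈-map⁻)
open import Data.List.Relation.Unary.All using (All; []; _∷_)
import Data.List.Relation.Unary.All as All
import Data.List.Relation.Unary.All.Properties as All
import Data.List.Relation.Unary.Any.Properties as Any
import Data.List.Relation.Unary.AllPairs as AllPairs
open import Data.List.Relation.Unary.Unique.Propositional using (Unique)
import Data.List.Relation.Unary.Unique.Propositional.Properties as Unique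
open import Data.Product using (_×_; _,_; ∃-syntax)
open import Data.Sum using (inj₁; inj₂)
open import Relation.Binary.PropositionalEquality
  using (_≡_; refl; sym; trans; cong; cong₂; subst; subst₂; module ≡-Reasoning)
open import Relation.Nullary using (¬_)

length-cartesianProductWith : ∀ {A B C : Set} (f : A → B → C) xs ys →
  length (cartesianProductWith f xs ys) ≡ length xs * length ys
length-cartesianProductWith f [] ys = refl
length-cartesianProductWith f (x ∷ xs) ys = begin
    length (map (f x) ys ++ cartesianProductWith f xs ys)
  ≡⟨ length-++ (map (f x) ys) ⟩
    length (map (f x) ys) + length (cartesianProductWith f xs ys)
  ≡⟨ cong₂ _+_ (length-map (f x) ys) (length-cartesianProductWith f xs ys) ⟩
    length ys + length xs * length ys ∎
  where open ≡-Reasoning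

All-drop-suc : ∀ {A : Set} {P : A → Set} {y xs} d → 0 ℕ.< d → All P xs → All P (drop d (y ∷ xs))
All-drop-suc (suc d) _ = All.drop⁺ d

module MarkerCode {q : ℕ} (S T : List (Fin q)) where

  wordsOver : (k : ℕ) → List (Vec (Fin q) k)
  wordsOver zero = [ [] ]
  wordsOver (suc k) = cartesianProductWith _∷_ T (wordsOver k)

  markerCode : (k : ℕ) → List (Word (suc k) q)
  markerCode k = cartesianProductWith _∷_ S (wordsOver k)

  ∈-wordsOver : ∀ k {w} → w ∈ wordsOver k → All (_∈ T) (toList w)
  ∈-wordsOver zero {[]} _ = []
  ∈-wordsOver (suc k) {x ∷ w} x∷w∈ =
    let x∈T , w∈ = Any.cartesianProductWith⁻ _∷_ Vec.∷-injective T (wordsOver k) x∷w∈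
    in x∈T ∷ ∈-wordsOver k w∈

  ∈-markerCode : ∀ k {x w} → x ∷ w ∈ markerCode k → x ∈ S × All (_∈ T) (toList w)
  ∈-markerCode k x∷w∈ =
    let x∈S , w∈ = Any.cartesianProductWith⁻ _∷_ Vec.∷-injective S (wordsOver k) x∷w∈
    in x∈S , ∈-wordsOver k w∈

  length-wordsOver : ∀ k → length (wordsOver k) ≡ length T ^ k
  length-wordsOver zero = refl
  length-wordsOver (suc k) =
    trans (length-cartesianProductWith _∷_ T (wordsOver k)) (cong (length T *_) (length-wordsOver k))

  length-markerCode : ∀ k → length (markerCode k) ≡ length S * length T ^ k
  length-markerCode k =
    trans (length-cartesianProductWith _∷_ S (wordsOver k)) (cong (length S *_) (length-wordsOver k))

  wordsOver-unique : Unique T → ∀ k → Unique (wordsOver k)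
  wordsOver-unique _ zero = [] AllPairs.∷ AllPairs.[]
  wordsOver-unique T! (suc k) =
    Unique.cartesianProductWith⁺ _∷_ Vec.∷-injective T! (wordsOver-unique T! k)

  markerCode-unique : Unique S → Unique T → ∀ k → Unique (markerCode k)
  markerCode-unique S! T! k =
    Unique.cartesianProductWith⁺ _∷_ Vec.∷-injective S! (wordsOver-unique T! k)

  module _ (S∩T≡∅ : ∀ {x} → x ∈ S → x ∉ T) where

    marker-not-suffix : ∀ k {x w y w'} → x ∈ S → All (_∈ T) (toList w') →
      ¬ PrefixIsSuffix {suc k} (x ∷ w) (y ∷ w')
    marker-not-suffix k {x} {w} {y} {w'} x∈S w'⊆T (suc j , _ , s≤s j<k , prefix≡suffix) =
      S∩T≡∅ x∈S (All.head prefix⊆T)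
      where
        prefix⊆T : All (_∈ T) (x ∷ take j (toList w))
        prefix⊆T = subst (All (_∈ T)) (sym prefix≡suffix)
                     (All-drop-suc (k ∸ j) (m<n⇒0<n∸m j<k) w'⊆T)

    markerCode-nonOverlapping : ∀ k → NonOverlapping (markerCode k)
    markerCode-nonOverlapping k (x ∷ w) (y ∷ w') u∈ v∈ (inj₁ u-prefix-v) =
      let x∈S , _ = ∈-markerCode k u∈ ; _ , w'⊆T = ∈-markerCode k v∈
      in marker-not-suffix k x∈S w'⊆T u-prefix-v
    markerCode-nonOverlapping k (x ∷ w) (y ∷ w') u∈ v∈ (inj₂ v-prefix-u) =
      let _ , w⊆T = ∈-markerCode k u∈ ; y∈S , _ = ∈-markerCode k v∈
      in marker-not-suffix k y∈S w⊆T v-prefix-u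

markers : (a t : ℕ) → List (Fin (a + t))
markers a t = map (_↑ˡ t) (allFin a)

nonMarkers : (a t : ℕ) → List (Fin (a + t))
nonMarkers a t = map (a ↑ʳ_) (allFin t)

markers∩nonMarkers≡∅ : ∀ a t {x} → x ∈ markers a t → x ∉ nonMarkers a t
markers∩nonMarkers≡∅ a t x∈ x∈' with ∈-map⁻ (_↑ˡ t) x∈ | ∈-map⁻ (a ↑ʳ_) x∈'
... | i , _ , refl | j , _ , i↑ˡt≡a↑ʳj
  with trans (sym (splitAt-↑ˡ a i t)) (trans (cong (splitAt a) i↑ˡt≡a↑ʳj) (splitAt-↑ʳ a t j))
... | ()

length-allFin-map : ∀ {A : Set} {n} (f : Fin n → A) → length (map f (allFin n)) ≡ n
length-allFin-map {n = n} f = trans (length-map f (allFin n)) (length-tabulate {n = n} (λ i → i))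

markerCode-size≤C : ∀ a t k {m} → IsC (suc k) (a + t) m → a * t ^ k ≤ m
markerCode-size≤C a t k (_ , maximal) =
  subst (_≤ _) size (maximal (markerCode k) (markerCode-unique S! T! k)
                       (markerCode-nonOverlapping (markers∩nonMarkers≡∅ a t) k))
  where
    open MarkerCode (markers a t) (nonMarkers a t)
    S! : Unique (markers a t)
    S! = Unique.map⁺ (↑ˡ-injective t _ _) (Unique.allFin⁺ a)
    T! : Unique (nonMarkers a t)
    T! = Unique.map⁺ (↑ʳ-injective a _ _) (Unique.allFin⁺ t)
    size : length (markerCode k) ≡ a * t ^ k
    size = trans (length-markerCode k)
                 (cong₂ (λ s r → s * r ^ k) (length-allFin-map {n = a} (_↑ˡ t))
                                            (length-allFin-map {n = t} (a ↑ʳ_)))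

balancedCodeSize : ℕ → ℕ → ℕ
balancedCodeSize k q = (q / suc k) * (q ∸ q / suc k) ^ k

balancedCodeSize≤C : ∀ k q {m} → IsC (suc k) q m → balancedCodeSize k q ≤ m
balancedCodeSize≤C k q {m} isC =
  markerCode-size≤C (q / suc k) (q ∸ q / suc k) k
    (subst (λ r → IsC (suc k) r m) (sym (m+[n∸m]≡n (m/n≤m q (suc k)))) isC)

^-distribʳ-* : ∀ m n k → (m * n) ^ k ≡ m ^ k * n ^ k
^-distribʳ-* m n zero = refl
^-distribʳ-* m n (suc k) = begin
    m * n * (m * n) ^ k     ≡⟨ cong (m * n *_) (^-distribʳ-* m n k) ⟩
    m * n * (m ^ k * n ^ k) ≡⟨ swap m n (m ^ k) (n ^ k) ⟩
    m * m ^ k * (n * n ^ k) ∎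
  where
    open ≡-Reasoning
    swap : ∀ m n x y → m * n * (x * y) ≡ m * x * (n * y)
    swap = solve-∀

^-meanValue-≤ : ∀ y e k → (y + e) ^ suc k ≤ y ^ suc k + suc k * e * (y + e) ^ k
^-meanValue-≤ y e zero = ≤-reflexive (linear y e)
  where
    linear : ∀ y e → (y + e) * 1 ≡ y * 1 + 1 * e * 1
    linear = solve-∀
^-meanValue-≤ y e (suc k) = begin
    (y + e) * (y + e) ^ suc k
  ≡⟨ *-distribʳ-+ ((y + e) ^ suc k) y e ⟩
    y * (y + e) ^ suc k + e * (y + e) ^ suc k
  ≤⟨ +-monoˡ-≤ _ (*-monoʳ-≤ y (^-meanValue-≤ y e k)) ⟩
    y * (y ^ suc k + suc k * e * X) + e * (y + e) ^ suc k
  ≡⟨ cong (_+ e * (y + e) ^ suc k) (expand y e (y ^ suc k) X k) ⟩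
    y * y ^ suc k + suc k * e * (y * X) + e * (y + e) ^ suc k
  ≤⟨ +-monoˡ-≤ _ (+-monoʳ-≤ (y * y ^ suc k) (*-monoʳ-≤ (suc k * e) (*-monoˡ-≤ X (m≤m+n y e)))) ⟩
    y * y ^ suc k + suc k * e * ((y + e) * X) + e * (y + e) ^ suc k
  ≡⟨ collect (y * y ^ suc k) e ((y + e) * X) k ⟩
    y * y ^ suc k + suc (suc k) * e * ((y + e) * X) ∎
  where
    open ≤-Reasoning
    X = (y + e) ^ k
    expand : ∀ y e Y X k → y * (Y + suc k * e * X) ≡ y * Y + suc k * e * (y * X)
    expand = solve-∀
    collect : ∀ A e Z k → A + suc k * e * Z + e * Z ≡ A + suc (suc k) * e * Z
    collect = solve-∀

^-≤-roundDown : ∀ k q → q ^ suc k ≤ (q / suc k * suc k) ^ suc k + suc k * suc k * q ^ k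
^-≤-roundDown k q = begin
    q ^ n                                   ≡⟨ cong (_^ n) q≡an+r ⟩
    (a * n + r) ^ n                         ≤⟨ ^-meanValue-≤ (a * n) r k ⟩
    (a * n) ^ n + n * r * (a * n + r) ^ k   ≡⟨ cong (λ x → (a * n) ^ n + n * r * x ^ k) (sym q≡an+r) ⟩
    (a * n) ^ n + n * r * q ^ k             ≤⟨ +-monoʳ-≤ ((a * n) ^ n) (*-monoˡ-≤ (q ^ k) (*-monoʳ-≤ n r≤n)) ⟩
    (a * n) ^ n + n * n * q ^ k             ∎
  where
    open ≤-Reasoning
    n = suc k
    a = q / n
    r = q % n
    q≡an+r : q ≡ a * n + r
    q≡an+r = trans (m≡m%n+[m/n]*n q n) (+-comm r (a * n))
    r≤n : r ≤ n
    r≤n = <⇒≤ (m%n<n q n)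

markerCodeSize-bound : ∀ k a t → k * a ≤ t → k ^ k * (a * suc k) ^ suc k ≤ suc k ^ k * (suc k * (a * t ^ k))
markerCodeSize-bound k a t ka≤t = begin
    k ^ k * (a * n) ^ n             ≡⟨ cong (k ^ k *_) (^-distribʳ-* a n n) ⟩
    k ^ k * (a ^ n * n ^ n)         ≡⟨ rearrange (k ^ k) a (a ^ k) n (n ^ k) ⟩
    n ^ k * (n * (a * (k ^ k * a ^ k))) ≡⟨ cong (λ x → n ^ k * (n * (a * x))) (sym (^-distribʳ-* k a k)) ⟩
    n ^ k * (n * (a * (k * a) ^ k)) ≤⟨ *-monoʳ-≤ (n ^ k) (*-monoʳ-≤ n (*-monoʳ-≤ a (^-monoˡ-≤ k ka≤t))) ⟩
    n ^ k * (n * (a * t ^ k))       ∎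
  where
    open ≤-Reasoning
    n = suc k
    rearrange : ∀ K a A n N → K * (a * A * (n * N)) ≡ N * (n * (a * (K * A)))
    rearrange = solve-∀

balancedCodeSize-bound : ∀ k q →
  k ^ k * q ^ suc k ≤ suc k ^ k * (suc k * balancedCodeSize k q) + k ^ k * (suc k * suc k * q ^ k)
balancedCodeSize-bound k q = begin
    k ^ k * q ^ n                              ≤⟨ *-monoʳ-≤ (k ^ k) (^-≤-roundDown k q) ⟩
    k ^ k * ((a * n) ^ n + n * n * q ^ k)      ≡⟨ *-distribˡ-+ (k ^ k) ((a * n) ^ n) _ ⟩
    k ^ k * (a * n) ^ n + k ^ k * (n * n * q ^ k)
      ≤⟨ +-monoˡ-≤ _ (markerCodeSize-bound k a (q ∸ a) ka≤q∸a) ⟩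
    n ^ k * (n * (a * (q ∸ a) ^ k)) + k ^ k * (n * n * q ^ k) ∎
  where
    open ≤-Reasoning
    n = suc k
    a = q / n
    ka≤q∸a : k * a ≤ q ∸ a
    ka≤q∸a = m+n≤o⇒m≤o∸n (k * a) (subst (_≤ q) (split a k) (m/n*n≤m q n))
      where
        split : ∀ a k → a * suc k ≡ k * a + a
        split = solve-∀

-- The cross-multiplied form of ((n-1)/n)^(n-1) q^n ≤ n m + (p/d) q^n, n = k + 1.
cross-multiplied-bound : ∀ k q m d p → 1 ≤ p → k ^ k * suc k * suc k * d ≤ q → balancedCodeSize k q ≤ m →
  k ^ k * q ^ suc k * d ≤ (suc k * m * d + p * q ^ suc k) * suc k ^ k
cross-multiplied-bound k q m d p 1≤p Q₀≤q code≤m = begin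
    k ^ k * q ^ n * d
  ≤⟨ *-monoˡ-≤ d (≤-trans (balancedCodeSize-bound k q)
                          (+-monoˡ-≤ _ (*-monoʳ-≤ (n ^ k) (*-monoʳ-≤ n code≤m)))) ⟩
    (n ^ k * (n * m) + k ^ k * (n * n * q ^ k)) * d
  ≡⟨ *-distribʳ-+ d (n ^ k * (n * m)) _ ⟩
    n ^ k * (n * m) * d + k ^ k * (n * n * q ^ k) * d
  ≤⟨ +-monoʳ-≤ (n ^ k * (n * m) * d) error≤q^n ⟩
    n ^ k * (n * m) * d + q ^ n
  ≤⟨ +-monoʳ-≤ (n ^ k * (n * m) * d) q^n≤pn^kq^n ⟩
    n ^ k * (n * m) * d + p * n ^ k * q ^ n
  ≡⟨ collect (n ^ k) n m d p (q ^ n) ⟩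
    (n * m * d + p * q ^ n) * n ^ k ∎
  where
    open ≤-Reasoning
    n = suc k
    error≤q^n : k ^ k * (n * n * q ^ k) * d ≤ q ^ n
    error≤q^n = begin
      k ^ k * (n * n * q ^ k) * d ≡⟨ regroup (k ^ k) n (q ^ k) d ⟩
      k ^ k * n * n * d * q ^ k   ≤⟨ *-monoˡ-≤ (q ^ k) Q₀≤q ⟩
      q * q ^ k                   ∎
      where
        regroup : ∀ K n Q d → K * (n * n * Q) * d ≡ K * n * n * d * Q
        regroup = solve-∀
    q^n≤pn^kq^n : q ^ n ≤ p * n ^ k * q ^ n
    q^n≤pn^kq^n = subst (_≤ p * n ^ k * q ^ n) (*-identityˡ (q ^ n))
                    (*-monoˡ-≤ (q ^ n) (*-mono-≤ 1≤p (m^n>0 n k)))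
    collect : ∀ N n m d p Q → N * (n * m) * d + p * N * Q ≡ (n * m * d + p * Q) * N
    collect = solve-∀

_^ᵘ_ : ℚᵘ → ℕ → ℚᵘ
x ^ᵘ zero = ℚᵘ.1ℚᵘ
x ^ᵘ suc k = x ℚᵘ.* (x ^ᵘ k)

^ᵘ-cong : ∀ {x y} k → x ℚᵘ.≃ y → x ^ᵘ k ℚᵘ.≃ y ^ᵘ k
^ᵘ-cong zero _ = ℚᵘ.≃-refl
^ᵘ-cong (suc k) x≃y = ℚᵘ.*-cong x≃y (^ᵘ-cong k x≃y)

toℚᵘ-homo-^ℚ : ∀ x k → toℚᵘ (x ^ℚ k) ℚᵘ.≃ toℚᵘ x ^ᵘ k
toℚᵘ-homo-^ℚ x zero = ℚᵘ.≃-refl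
toℚᵘ-homo-^ℚ x (suc k) = ℚᵘ.≃-trans (toℚᵘ-homo-* x (x ^ℚ k)) (ℚᵘ.*-congˡ {toℚᵘ x} (toℚᵘ-homo-^ℚ x k))

toℚᵘ-const : ∀ k → toℚᵘ (const (suc k)) ℚᵘ.≃ mkℚᵘ (+ k) k ^ᵘ k
toℚᵘ-const k = ℚᵘ.≃-trans (toℚᵘ-homo-^ℚ (frac k (suc k)) k) (^ᵘ-cong k (toℚᵘ-fromℚᵘ (mkℚᵘ (+ k) k)))

↥-* : ∀ x y → ↥ (x ℚᵘ.* y) ≡ ↥ x ℤ.* ↥ y
↥-* (mkℚᵘ _ _) (mkℚᵘ _ _) = refl

↧ₙ-* : ∀ x y → ↧ₙ (x ℚᵘ.* y) ≡ ↧ₙ x * ↧ₙ y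
↧ₙ-* (mkℚᵘ _ _) (mkℚᵘ _ _) = refl

↥-^ᵘ : ∀ {x a} k → ↥ x ≡ + a → ↥ (x ^ᵘ k) ≡ + a ^ k
↥-^ᵘ zero _ = refl
↥-^ᵘ {x} {a} (suc k) ↥x≡a = begin
  ↥ (x ℚᵘ.* x ^ᵘ k)      ≡⟨ ↥-* x (x ^ᵘ k) ⟩
  ↥ x ℤ.* ↥ (x ^ᵘ k)     ≡⟨ cong₂ ℤ._*_ ↥x≡a (↥-^ᵘ k ↥x≡a) ⟩
  + a ℤ.* + a ^ k        ≡⟨ ℤ.pos-* a (a ^ k) ⟨
  + (a * a ^ k)          ∎
  where open ≡-Reasoning

↧ₙ-^ᵘ : ∀ {x b} k → ↧ₙ x ≡ b → ↧ₙ (x ^ᵘ k) ≡ b ^ k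
↧ₙ-^ᵘ zero _ = refl
↧ₙ-^ᵘ {x} (suc k) ↧ₙx≡b = trans (↧ₙ-* x (x ^ᵘ k)) (cong₂ _*_ ↧ₙx≡b (↧ₙ-^ᵘ k ↧ₙx≡b))

≤ᵘ-cross : ∀ {x y : ℚᵘ} {a b c d} → ↥ x ≡ + a → ↧ₙ x ≡ b → ↥ y ≡ + c → ↧ₙ y ≡ d →
  a * d ≤ c * b → x ℚᵘ.≤ y
≤ᵘ-cross {mkℚᵘ _ _} {mkℚᵘ _ _} {a} {b} {c} {d} refl refl refl refl ad≤cb =
  ℚᵘ.*≤* (subst₂ ℤ._≤_ (ℤ.pos-* a d) (ℤ.pos-* c b) (ℤ.+≤+ ad≤cb))

≤+*⇒-*≤ : ∀ c e x m → c ℚᵘ.* x ℚᵘ.≤ m ℚᵘ.+ e ℚᵘ.* x → (c ℚᵘ.- e) ℚᵘ.* x ℚᵘ.≤ m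
≤+*⇒-*≤ c e x m cx≤m+ex =
  ℚᵘ.≤-respʳ-≃ cancel (ℚᵘ.≤-respˡ-≃ (ℚᵘ.≃-sym distrib) (ℚᵘ.+-monoˡ-≤ (ℚᵘ.- (e ℚᵘ.* x)) cx≤m+ex))
  where
    open +-*-Solver
    distrib : (c ℚᵘ.- e) ℚᵘ.* x ℚᵘ.≃ c ℚᵘ.* x ℚᵘ.+ ℚᵘ.- (e ℚᵘ.* x)
    distrib = solve 3 (λ c e x → (c :- e) :* x := c :* x :+ (:- (e :* x))) ℚᵘ.≃-refl c e x
    cancel : m ℚᵘ.+ e ℚᵘ.* x ℚᵘ.+ ℚᵘ.- (e ℚᵘ.* x) ℚᵘ.≃ m
    cancel = solve 2 (λ m y → m :+ y :+ (:- y) := m) ℚᵘ.≃-refl m (e ℚᵘ.* x)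

cross-multiplied⇒bound : ∀ k (ε : ℚ) {p d} A M → Q.↥ ε ≡ + p → Q.↧ₙ ε ≡ d →
  k ^ k * A * d ≤ (M * d + p * A) * suc k ^ k →
  (const (suc k) - ε) Q.* ℕ→ℚ A Q.≤ ℕ→ℚ M
cross-multiplied⇒bound k ε@(mkℚ _ _ _) {p} {d} A M refl refl cross =
  toℚᵘ-cancel-≤ (ℚᵘ.≤-respˡ-≃ (ℚᵘ.≃-sym lhs) (ℚᵘ.≤-respʳ-≃ (ℚᵘ.≃-sym (toℚᵘ-fromℚᵘ Mᵘ))
    (≤+*⇒-*≤ c (toℚᵘ ε) Aᵘ Mᵘ (≤ᵘ-cross ↥cA ↧ₙcA ↥M+εA ↧ₙM+εA cross))))
  where
    open ≡-Reasoning
    c = mkℚᵘ (+ k) k ^ᵘ k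
    Aᵘ = mkℚᵘ (+ A) 0
    Mᵘ = mkℚᵘ (+ M) 0
    lhs : toℚᵘ ((const (suc k) - ε) Q.* ℕ→ℚ A) ℚᵘ.≃ (c ℚᵘ.- toℚᵘ ε) ℚᵘ.* Aᵘ
    lhs = ℚᵘ.≃-trans (toℚᵘ-homo-* (const (suc k) - ε) (ℕ→ℚ A))
            (ℚᵘ.*-cong (ℚᵘ.≃-trans (toℚᵘ-homo-+ (const (suc k)) (Q.- ε))
                                   (ℚᵘ.+-cong (toℚᵘ-const k) (toℚᵘ-homo‿- ε)))
                       (toℚᵘ-fromℚᵘ Aᵘ))
    ↥cA : ↥ (c ℚᵘ.* Aᵘ) ≡ + (k ^ k * A)
    ↥cA = begin
      ↥ (c ℚᵘ.* Aᵘ)       ≡⟨ ↥-* c Aᵘ ⟩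
      ↥ c ℤ.* + A         ≡⟨ cong (ℤ._* + A) (↥-^ᵘ k refl) ⟩
      + k ^ k ℤ.* + A     ≡⟨ ℤ.pos-* (k ^ k) A ⟨
      + (k ^ k * A)       ∎
    ↧ₙcA : ↧ₙ (c ℚᵘ.* Aᵘ) ≡ suc k ^ k
    ↧ₙcA = trans (↧ₙ-* c Aᵘ) (trans (*-identityʳ _) (↧ₙ-^ᵘ k refl))
    ↥M+εA : ↥ (Mᵘ ℚᵘ.+ toℚᵘ ε ℚᵘ.* Aᵘ) ≡ + (M * d + p * A)
    ↥M+εA = begin
      + M ℤ.* + (d * 1) ℤ.+ + p ℤ.* + A ℤ.* + 1
        ≡⟨ cong₂ (λ x y → + M ℤ.* + x ℤ.+ y) (*-identityʳ d) (ℤ.*-identityʳ (+ p ℤ.* + A)) ⟩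
      + M ℤ.* + d ℤ.+ + p ℤ.* + A   ≡⟨ cong₂ ℤ._+_ (ℤ.pos-* M d) (ℤ.pos-* p A) ⟨
      + (M * d) ℤ.+ + (p * A)       ≡⟨ ℤ.pos-+ (M * d) (p * A) ⟨
      + (M * d + p * A)             ∎
    ↧ₙM+εA : ↧ₙ (Mᵘ ℚᵘ.+ toℚᵘ ε ℚᵘ.* Aᵘ) ≡ d
    ↧ₙM+εA = trans (*-identityˡ (d * 1)) (*-identityʳ d)

numerator-of-positive : ∀ {ε} → 0ℚ < ε → ∃[ p ] Q.↥ ε ≡ + suc p
numerator-of-positive {mkℚ +[1+ p ] _ _} _ = p , refl
numerator-of-positive {mkℚ (+ 0) _ _} (*<* (ℤ.+<+ ()))
numerator-of-positive {mkℚ -[1+ _ ] _ _} (*<* ())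

theorem5 : (n : ℕ) → 2 ≤ n → (ε : ℚ) → 0ℚ < ε →
    ∃[ Q₀ ] (∀ (q m : ℕ) → Q₀ ≤ q → IsC n q m →
    (const n - ε) Q.* ℕ→ℚ (q ^ n) Q.≤ ℕ→ℚ (n * m))
-- n ≥ 2 only rules out n = 0: for n = 1 the bound C(1,q) ≥ q holds by the same argument.
theorem5 zero () _ _
theorem5 (suc k) _ ε 0<ε with numerator-of-positive 0<ε
... | p , ↥ε≡1+p = k ^ k * suc k * suc k * Q.↧ₙ ε , λ q m Q₀≤q isC →
  cross-multiplied⇒bound k ε (q ^ suc k) (suc k * m) ↥ε≡1+p refl
    (cross-multiplied-bound k q m (Q.↧ₙ ε) (suc p) (s≤s z≤n) Q₀≤q (balancedCodeSize≤C k q isC))
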